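{- Let $n,m$ be positive integers, $0\le d<r\le\min\{m,n\}$, and $\mathcal{R}\in\mathcal{Z}_{n,m,d}$. Then \[\mathfrak{m}(\mathcal{R})\equiv\frac{1}{r-d}\sum_{\mathcal{R}'}\mathfrak{m}(\mathcal{R}')\pmod{\mathbf{I}(\mathcal{Z}_{n,m,r})},\] where the sum runs over all rook placements $\mathcal{R}'\in\mathcal{Z}_{n,m,d+1}$ with $\mathcal{R}\subseteq\mathcal{R}'$.
   Context: $\mathbb{C}[\mathbf{x}_{n\times m}]$ is the polynomial ring in variables $x_{i,j}$ ($1\le i\le n,1\le j\le m$). A rook placement on the $n\times m$ board is a subset of $[n]\times[m]$ with at most one element in each row and column, identified with its $0/1$ matrix; $\mathcal{Z}_{n,m,d}$ is the set of rook placements with exactly $d$ rooks; $\mathfrak{m}(\mathcal{R})=\prod_{(i,j)\in\mathcal{R}}x_{i,j}$. $\mathbf{I}(\mathcal{Z})$ is the ideal of polynomials vanishing on the finite set $\mathcal{Z}$ of matrices. -}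

module Defs where

open import Data.Nat using (ℕ; zero; suc; _+_; _≤ᵇ_; _≡ᵇ_)
open import Data.Bool using (Bool; true; false; _∧_; if_then_else_)
open import Data.Fin using (Fin; zero; suc)
open import Data.List using (List; []; _∷_; map; concatMap; foldr; _++_; filterᵇ)
open import Data.Product using (_×_; _,_)
open import Data.Rational using (ℚ; 0ℚ; 1ℚ; -_) renaming (_+_ to _+ℚ_; _*_ to _*ℚ_)
open import Data.Rational.Unnormalised using ()
import Data.Rational as ℚ
import Data.Integer as ℤ
open import Relation.Binary.PropositionalEquality using (_≡_)

sumF : (k : ℕ) → (Fin k → ℕ) → ℕ
sumF zero    f = 0
sumF (suc k) f = f zero + sumF k (λ i → f (suc i))

prodQ : (k : ℕ) → (Fin k → ℚ) → ℚ
prodQ zero    f = 1ℚ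
prodQ (suc k) f = f zero *ℚ prodQ k (λ i → f (suc i))

allF : (k : ℕ) → (Fin k → Bool) → Bool
allF zero    f = true
allF (suc k) f = f zero ∧ allF k (λ i → f (suc i))

cons : ∀ {A : Set} {k : ℕ} → A → (Fin k → A) → Fin (suc k) → A
cons a f zero    = a
cons a f (suc i) = f i

allFuns : ∀ {A : Set} → List A → (k : ℕ) → List (Fin k → A)
allFuns xs zero    = (λ ()) ∷ []
allFuns xs (suc k) = concatMap (λ a → map (cons a) (allFuns xs k)) xs

-- 0/1 matrices of size n × m (true = 1); a subset of [n]×[m]
Mat : ℕ → ℕ → Set
Mat n m = Fin n → Fin m → Bool

allMats : (n m : ℕ) → List (Mat n m)
allMats n m = allFuns (allFuns (true ∷ false ∷ []) m) n

b2n : Bool → ℕ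
b2n true  = 1
b2n false = 0

rowCount : ∀ {n m} → Mat n m → Fin n → ℕ
rowCount {n} {m} P i = sumF m (λ j → b2n (P i j))

colCount : ∀ {n m} → Mat n m → Fin m → ℕ
colCount {n} {m} P j = sumF n (λ i → b2n (P i j))

isRook : ∀ {n m} → Mat n m → Bool
isRook {n} {m} P = allF n (λ i → rowCount P i ≤ᵇ 1) ∧ allF m (λ j → colCount P j ≤ᵇ 1)

size : ∀ {n m} → Mat n m → ℕ
size {n} {m} P = sumF n (λ i → rowCount P i)

inZᵇ : (n m d : ℕ) → Mat n m → Bool
inZᵇ n m d P = isRook P ∧ (size P ≡ᵇ d)

InZ : (n m d : ℕ) → Mat n m → Set
InZ n m d P = inZᵇ n m d P ≡ true

subsetᵇ : ∀ {n m} → Mat n m → Mat n m → Bool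
subsetᵇ {n} {m} R R' = allF n (λ i → allF m (λ j → if R i j then R' i j else true))

-- Polynomials in ℚ[x_{i,j}] as formal linear combinations of monomials;
-- a monomial is given by its exponent matrix.

Exp : ℕ → ℕ → Set
Exp n m = Fin n → Fin m → ℕ

Poly : ℕ → ℕ → Set
Poly n m = List (ℚ × Exp n m)

powQ : ℚ → ℕ → ℚ
powQ q zero    = 1ℚ
powQ q (suc k) = q *ℚ powQ q k

entry : Bool → ℚ
entry true  = 1ℚ
entry false = 0ℚ

evalMono : ∀ {n m} → Exp n m → Mat n m → ℚ
evalMono {n} {m} e P = prodQ n (λ i → prodQ m (λ j → powQ (entry (P i j)) (e i j)))

evalPoly : ∀ {n m} → Poly n m → Mat n m → ℚ
evalPoly f P = foldr (λ { (c , e) acc → (c *ℚ evalMono e P) +ℚ acc }) 0ℚ f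

monoR : ∀ {n m} → Mat n m → Exp n m
monoR R i j = b2n (R i j)

mono : ∀ {n m} → Mat n m → Poly n m
mono R = (1ℚ , monoR R) ∷ []

scale : ∀ {n m} → ℚ → Poly n m → Poly n m
scale c = map (λ { (a , e) → (c *ℚ a , e) })

_-P_ : ∀ {n m} → Poly n m → Poly n m → Poly n m
f -P g = f ++ scale (- 1ℚ) g

InIdealZ : (n m r : ℕ) → Poly n m → Set
InIdealZ n m r f = (P : Mat n m) → InZ n m r P → evalPoly f P ≡ 0ℚ

CongModZ : (n m r : ℕ) → Poly n m → Poly n m → Set
CongModZ n m r f g = InIdealZ n m r (f -P g)

-- 1/k as a rational (only used with k ≥ 1; inv 0 = 0 by convention)
inv : ℕ → ℚ
inv zero    = 0ℚ
inv (suc k) = (ℤ.+ 1) ℚ./ (suc k)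

extSum : ∀ {n m} → (d : ℕ) → Mat n m → Poly n m
extSum {n} {m} d R =
  concatMap mono (filterᵇ (λ R' → inZᵇ n m (suc d) R' ∧ subsetᵇ R R') (allMats n m))

module Submission where

-- Evaluate both sides at a point P of Z_{n,m,r}. The monomial 𝔪(R) gives [R ⊆ P]. The sum gives the
-- number of placements R' ⊇ R with d + 1 rooks inside P; since every subset of a rook placement is one,
-- these are the R ∪ {c} with c ∈ P ∖ R, and there are r − d of them when R ⊆ P. The count is done in the
-- dual numbers ℕ[ε]/(ε²): the weight [R ⊆ S ⊆ P] ε^|S ∖ R| has ε-coefficient 1 exactly for such S, and its
-- sum over all 0/1 matrices S factors over the cells into [R ⊆ P] (1 + ε)^|P ∖ R|.

open import Defs
open import Data.Nat using (ℕ; _<_; _≤_; _∸_)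
open import Data.Nat using (suc)

open import Algebra.Bundles using (CommutativeMonoid; Semiring; CommutativeSemiring)
open import Algebra.Structures using (IsCommutativeMonoid)
open import Algebra.Structures.Biased using (isCommutativeMonoidˡ; isCommutativeSemiringʳ)
open import Data.Bool using (Bool; true; false; _∧_; not; if_then_else_)
import Data.Bool.Properties as Bool
open import Data.Fin using (Fin; zero; suc)
open import Data.List using (List; []; _∷_; map; concatMap; _++_; filterᵇ)
open import Data.Nat using (zero)
import Data.Nat.Properties as ℕ
open import Data.Nat.Coprimality using (1-coprimeTo) renaming (sym to coprime-sym)
open import Data.Nat.Tactic.RingSolver using (solve-∀)
open import Data.Product using (_×_; _,_; proj₁; proj₂)
open import Data.Rational as ℚ using (ℚ; mkℚ; 0ℚ; 1ℚ; -_)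
import Data.Rational.Properties as ℚ
import Data.Integer as ℤ
import Data.Integer.Properties as ℤ
open import Function using (Equivalence)
open import Level using (0ℓ)
open import Relation.Binary.PropositionalEquality using (_≡_; refl; sym; trans; cong; cong₂; isEquivalence; module ≡-Reasoning)

module SumsAndProducts {c ℓ} (S : Semiring c ℓ) where

  open Semiring S hiding (zero) renaming (refl to ≈-refl; sym to ≈-sym; trans to ≈-trans)
  open import Algebra.Properties.Semiring.Exp S using (_^_; ^-homo-*)
  open import Relation.Binary.Reasoning.Setoid setoid

  ∑ : {X : Set} → List X → (X → Carrier) → Carrier
  ∑ []       f = 0#
  ∑ (x ∷ xs) f = f x + ∑ xs f

  ∏ : (k : ℕ) → (Fin k → Carrier) → Carrier
  ∏ zero    f = 1#
  ∏ (suc k) f = f zero * ∏ k (λ i → f (suc i))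

  ∑-cong : {X : Set} (xs : List X) {f g : X → Carrier} → (∀ x → f x ≈ g x) → ∑ xs f ≈ ∑ xs g
  ∑-cong []       f≈g = ≈-refl
  ∑-cong (x ∷ xs) f≈g = +-cong (f≈g x) (∑-cong xs f≈g)

  ∏-cong : (k : ℕ) {f g : Fin k → Carrier} → (∀ i → f i ≈ g i) → ∏ k f ≈ ∏ k g
  ∏-cong zero    f≈g = ≈-refl
  ∏-cong (suc k) f≈g = *-cong (f≈g zero) (∏-cong k (λ i → f≈g (suc i)))

  ∑-++ : {X : Set} (xs ys : List X) (f : X → Carrier) → ∑ (xs ++ ys) f ≈ ∑ xs f + ∑ ys f
  ∑-++ []       ys f = ≈-sym (+-identityˡ (∑ ys f))
  ∑-++ (x ∷ xs) ys f = begin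
    f x + ∑ (xs ++ ys) f       ≈⟨ +-congˡ (∑-++ xs ys f) ⟩
    f x + (∑ xs f + ∑ ys f)    ≈⟨ +-assoc (f x) (∑ xs f) (∑ ys f) ⟨
    (f x + ∑ xs f) + ∑ ys f    ∎

  ∑-map : {X Y : Set} (g : X → Y) (xs : List X) (f : Y → Carrier) → ∑ (map g xs) f ≡ ∑ xs (λ x → f (g x))
  ∑-map g []       f = refl
  ∑-map g (x ∷ xs) f = cong (f (g x) +_) (∑-map g xs f)

  ∑-concatMap : {X Y : Set} (h : X → List Y) (xs : List X) (f : Y → Carrier) →
                ∑ (concatMap h xs) f ≈ ∑ xs (λ x → ∑ (h x) f)
  ∑-concatMap h []       f = ≈-refl
  ∑-concatMap h (x ∷ xs) f = begin
    ∑ (h x ++ concatMap h xs) f          ≈⟨ ∑-++ (h x) (concatMap h xs) f ⟩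
    ∑ (h x) f + ∑ (concatMap h xs) f     ≈⟨ +-congˡ (∑-concatMap h xs f) ⟩
    ∑ (h x) f + ∑ xs (λ y → ∑ (h y) f)   ∎

  ∑-*ˡ : {X : Set} (a : Carrier) (xs : List X) (f : X → Carrier) → ∑ xs (λ x → a * f x) ≈ a * ∑ xs f
  ∑-*ˡ a []       f = ≈-sym (zeroʳ a)
  ∑-*ˡ a (x ∷ xs) f = ≈-trans (+-congˡ (∑-*ˡ a xs f)) (≈-sym (distribˡ a (f x) (∑ xs f)))

  ∑-*ʳ : {X : Set} (a : Carrier) (xs : List X) (f : X → Carrier) → ∑ xs (λ x → f x * a) ≈ ∑ xs f * a
  ∑-*ʳ a []       f = ≈-sym (zeroˡ a)
  ∑-*ʳ a (x ∷ xs) f = ≈-trans (+-congˡ (∑-*ʳ a xs f)) (≈-sym (distribʳ a (f x) (∑ xs f)))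

  ∑-allFuns-∏ : {X : Set} (xs : List X) (k : ℕ) (g : Fin k → X → Carrier) →
                ∑ (allFuns xs k) (λ φ → ∏ k (λ i → g i (φ i))) ≈ ∏ k (λ i → ∑ xs (g i))
  ∑-allFuns-∏ xs zero    g = +-identityʳ 1#
  ∑-allFuns-∏ xs (suc k) g = begin
    ∑ (concatMap (λ a → map (cons a) (allFuns xs k)) xs) G
      ≈⟨ ∑-concatMap (λ a → map (cons a) (allFuns xs k)) xs G ⟩
    ∑ xs (λ a → ∑ (map (cons a) (allFuns xs k)) G)
      ≈⟨ ∑-cong xs (λ a → reflexive (∑-map (cons a) (allFuns xs k) G)) ⟩
    ∑ xs (λ a → ∑ (allFuns xs k) (λ φ → g zero a * G′ φ))
      ≈⟨ ∑-cong xs (λ a → ∑-*ˡ (g zero a) (allFuns xs k) G′) ⟩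
    ∑ xs (λ a → g zero a * ∑ (allFuns xs k) G′)
      ≈⟨ ∑-cong xs (λ a → *-congˡ (∑-allFuns-∏ xs k (λ i → g (suc i)))) ⟩
    ∑ xs (λ a → g zero a * ∏ k (λ i → ∑ xs (g (suc i))))
      ≈⟨ ∑-*ʳ _ xs (g zero) ⟩
    ∏ (suc k) (λ i → ∑ xs (g i)) ∎
    where
    G : (Fin (suc k) → _) → Carrier
    G φ = ∏ (suc k) (λ i → g i (φ i))
    G′ : (Fin k → _) → Carrier
    G′ ψ = ∏ k (λ i → g (suc i) (ψ i))

  infixr 8 [_]·_

  [_]·_ : Bool → Carrier → Carrier
  [ v ]· x = if v then x else 0#

  []·-congʳ : ∀ v {x y} → x ≈ y → [ v ]· x ≈ [ v ]· y
  []·-congʳ true  x≈y = x≈y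
  []·-congʳ false x≈y = ≈-refl

  []·-* : ∀ v w x y → ([ v ]· x) * ([ w ]· y) ≈ [ v ∧ w ]· (x * y)
  []·-* true  true  x y = ≈-refl
  []·-* true  false x y = zeroʳ x
  []·-* false w     x y = zeroˡ ([ w ]· y)

  ∏-[]·-^ : ∀ k (v : Fin k → Bool) (e : Fin k → ℕ) x →
            ∏ k (λ i → [ v i ]· x ^ e i) ≈ [ allF k v ]· x ^ sumF k e
  ∏-[]·-^ zero    v e x = ≈-refl
  ∏-[]·-^ (suc k) v e x = begin
    [ v zero ]· x ^ e zero * ∏ k (λ i → [ v (suc i) ]· x ^ e (suc i))
      ≈⟨ *-congˡ (∏-[]·-^ k (λ i → v (suc i)) (λ i → e (suc i)) x) ⟩
    [ v zero ]· x ^ e zero * [ allF k (λ i → v (suc i)) ]· x ^ sumF k (λ i → e (suc i))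
      ≈⟨ []·-* (v zero) _ _ _ ⟩
    [ allF (suc k) v ]· (x ^ e zero * x ^ sumF k (λ i → e (suc i)))
      ≈⟨ []·-congʳ (allF (suc k) v) (^-homo-* x (e zero) _) ⟨
    [ allF (suc k) v ]· x ^ sumF (suc k) e ∎

open import Data.Nat using (_+_; _*_; _≡ᵇ_; _≤ᵇ_; z≤n; s≤s)
open import Algebra.Properties.CommutativeSemigroup ℕ.+-commutativeSemigroup
  using () renaming (interchange to +-interchange)
open import Algebra.Properties.CommutativeSemigroup (CommutativeMonoid.commutativeSemigroup Bool.∧-commutativeMonoid)
  using () renaming (interchange to ∧-interchange)

sumF-cong : ∀ k {f g : Fin k → ℕ} → (∀ i → f i ≡ g i) → sumF k f ≡ sumF k g
sumF-cong zero    f≡g = refl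
sumF-cong (suc k) f≡g = cong₂ _+_ (f≡g zero) (sumF-cong k (λ i → f≡g (suc i)))

sumF-+ : ∀ k (f g : Fin k → ℕ) → sumF k (λ i → f i + g i) ≡ sumF k f + sumF k g
sumF-+ zero    f g = refl
sumF-+ (suc k) f g rewrite sumF-+ k (λ i → f (suc i)) (λ i → g (suc i)) =
  +-interchange (f zero) (g zero) (sumF k (λ i → f (suc i))) (sumF k (λ i → g (suc i)))

sumF-mono-≤ : ∀ k {f g : Fin k → ℕ} → (∀ i → f i ≤ g i) → sumF k f ≤ sumF k g
sumF-mono-≤ zero    f≤g = z≤n
sumF-mono-≤ (suc k) f≤g = ℕ.+-mono-≤ (f≤g zero) (sumF-mono-≤ k (λ i → f≤g (suc i)))

allF-cong : ∀ k {f g : Fin k → Bool} → (∀ i → f i ≡ g i) → allF k f ≡ allF k g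
allF-cong zero    f≡g = refl
allF-cong (suc k) f≡g = cong₂ _∧_ (f≡g zero) (allF-cong k (λ i → f≡g (suc i)))

allF-∧ : ∀ k (f g : Fin k → Bool) → allF k (λ i → f i ∧ g i) ≡ allF k f ∧ allF k g
allF-∧ zero    f g = refl
allF-∧ (suc k) f g rewrite allF-∧ k (λ i → f (suc i)) (λ i → g (suc i)) =
  ∧-interchange (f zero) (g zero) (allF k (λ i → f (suc i))) (allF k (λ i → g (suc i)))

allF⇒ : ∀ k {f : Fin k → Bool} → allF k f ≡ true → ∀ i → f i ≡ true
allF⇒ (suc k) {f} all i with f zero in f₀
allF⇒ (suc k) {f} all zero    | true = f₀
allF⇒ (suc k) {f} all (suc i) | true = allF⇒ k all i

⇒allF : ∀ k {f : Fin k → Bool} → (∀ i → f i ≡ true) → allF k f ≡ true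
⇒allF zero    f≡true = refl
⇒allF (suc k) f≡true rewrite f≡true zero = ⇒allF k (λ i → f≡true (suc i))

∧≡true⇒both : ∀ {a b} → a ∧ b ≡ true → a ≡ true × b ≡ true
∧≡true⇒both {true} {true} _ = refl , refl

infixl 6 _∖_

_∖_ : ∀ {n m} → Mat n m → Mat n m → Mat n m
(S ∖ R) i j = S i j ∧ not (R i j)

subsetᵇ⇒cell : ∀ {n m} {R S : Mat n m} → subsetᵇ R S ≡ true → ∀ i j → (if R i j then S i j else true) ≡ true
subsetᵇ⇒cell {n} {m} R⊆S i j = allF⇒ m (allF⇒ n R⊆S i) j

size-∖ : ∀ {n m} (R S : Mat n m) → subsetᵇ R S ≡ true → size S ≡ size R + size (S ∖ R)
size-∖ {n} {m} R S R⊆S =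
  trans (sumF-cong n (λ i → trans (sumF-cong m (λ j → cell (R i j) (S i j) (subsetᵇ⇒cell {R = R} R⊆S i j)))
                                  (sumF-+ m _ _)))
        (sumF-+ n _ _)
  where
  cell : ∀ r s → (if r then s else true) ≡ true → b2n s ≡ b2n r + b2n (s ∧ not r)
  cell true  true  _ = refl
  cell false true  _ = refl
  cell false false _ = refl

size-∖≡∸ : ∀ {n m} (R S : Mat n m) → subsetᵇ R S ≡ true → size (S ∖ R) ≡ size S ∸ size R
size-∖≡∸ R S R⊆S = trans (sym (ℕ.m+n∸m≡n (size R) (size (S ∖ R)))) (cong (_∸ size R) (sym (size-∖ R S R⊆S)))

≤-≤ᵇ-trans : ∀ {a b c} → a ≤ b → (b ≤ᵇ c) ≡ true → (a ≤ᵇ c) ≡ true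
≤-≤ᵇ-trans {a} {b} {c} a≤b b≤ᵇc = Equivalence.to Bool.T-≡
  (ℕ.≤⇒≤ᵇ (ℕ.≤-trans a≤b (ℕ.≤ᵇ⇒≤ b c (Equivalence.from Bool.T-≡ b≤ᵇc))))

isRook-⊆ : ∀ {n m} (S P : Mat n m) → subsetᵇ S P ≡ true → isRook P ≡ true → isRook S ≡ true
isRook-⊆ {n} {m} S P S⊆P rook with ∧≡true⇒both {allF n (λ i → rowCount P i ≤ᵇ 1)} rook
... | rows , cols = cong₂ _∧_
  (⇒allF n (λ i → ≤-≤ᵇ-trans (sumF-mono-≤ m (λ j → cell (S i j) (P i j) (subsetᵇ⇒cell {R = S} S⊆P i j))) (allF⇒ n rows i)))
  (⇒allF m (λ j → ≤-≤ᵇ-trans (sumF-mono-≤ n (λ i → cell (S i j) (P i j) (subsetᵇ⇒cell {R = S} S⊆P i j))) (allF⇒ m cols j)))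
  where
  cell : ∀ s p → (if s then p else true) ≡ true → b2n s ≤ b2n p
  cell true  true _ = s≤s z≤n
  cell false p    _ = z≤n

isExtensionᵇ : ∀ {n m} → ℕ → Mat n m → Mat n m → Bool
isExtensionᵇ {n} {m} d R S = inZᵇ n m (suc d) S ∧ subsetᵇ R S

≡ᵇ-+ˡ : ∀ d e → (d + e ≡ᵇ suc d) ≡ (e ≡ᵇ 1)
≡ᵇ-+ˡ zero    e = refl
≡ᵇ-+ˡ (suc d) e = ≡ᵇ-+ˡ d e

isExtensionᵇ-between : ∀ {n m} d (R S P : Mat n m) → size R ≡ d → isRook P ≡ true →
  subsetᵇ R S ≡ true → subsetᵇ S P ≡ true → isExtensionᵇ d R S ≡ (size (S ∖ R) ≡ᵇ 1)
isExtensionᵇ-between d R S P |R|≡d rook R⊆S S⊆P = begin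
  (isRook S ∧ (size S ≡ᵇ suc d)) ∧ subsetᵇ R S
    ≡⟨ cong₂ (λ a b → (a ∧ (size S ≡ᵇ suc d)) ∧ b) (isRook-⊆ S P S⊆P rook) R⊆S ⟩
  (size S ≡ᵇ suc d) ∧ true
    ≡⟨ Bool.∧-identityʳ _ ⟩
  (size S ≡ᵇ suc d)
    ≡⟨ cong (_≡ᵇ suc d) (trans (size-∖ R S R⊆S) (cong (_+ size (S ∖ R)) |R|≡d)) ⟩
  (d + size (S ∖ R) ≡ᵇ suc d)
    ≡⟨ ≡ᵇ-+ˡ d (size (S ∖ R)) ⟩
  (size (S ∖ R) ≡ᵇ 1) ∎
  where open ≡-Reasoning

-- a + bε is represented as (a , b).
𝔻 : Set
𝔻 = ℕ × ℕ

infixl 6 _+ᴰ_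
infixl 7 _*ᴰ_

_+ᴰ_ : 𝔻 → 𝔻 → 𝔻
(a , b) +ᴰ (c , d) = (a + c , b + d)

_*ᴰ_ : 𝔻 → 𝔻 → 𝔻
(a , b) *ᴰ (c , d) = (a * c , a * d + b * c)

0ᴰ 1ᴰ ε : 𝔻
0ᴰ = (0 , 0)
1ᴰ = (1 , 0)
ε  = (0 , 1)

+ᴰ-isCommutativeMonoid : IsCommutativeMonoid _≡_ _+ᴰ_ 0ᴰ
+ᴰ-isCommutativeMonoid = isCommutativeMonoidˡ record
  { isSemigroup = record
    { isMagma = record { isEquivalence = isEquivalence ; ∙-cong = cong₂ _+ᴰ_ }
    ; assoc   = λ { (a , b) (c , d) (e , f) → cong₂ _,_ (ℕ.+-assoc a c e) (ℕ.+-assoc b d f) }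
    }
  ; identityˡ = λ _ → refl
  ; comm      = λ { (a , b) (c , d) → cong₂ _,_ (ℕ.+-comm a c) (ℕ.+-comm b d) }
  }

*ᴰ-isCommutativeMonoid : IsCommutativeMonoid _≡_ _*ᴰ_ 1ᴰ
*ᴰ-isCommutativeMonoid = isCommutativeMonoidˡ record
  { isSemigroup = record
    { isMagma = record { isEquivalence = isEquivalence ; ∙-cong = cong₂ _*ᴰ_ }
    ; assoc   = λ { (a , b) (c , d) (e , f) → cong₂ _,_ (ℕ.*-assoc a c e) (assoc₂ a b c d e f) }
    }
  ; identityˡ = λ { (a , b) → cong₂ _,_ (ℕ.+-identityʳ a) (identityˡ₂ a b) }
  ; comm      = λ { (a , b) (c , d) → cong₂ _,_ (ℕ.*-comm a c) (comm₂ a b c d) }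
  }
  where
  assoc₂ : ∀ a b c d e f → a * c * f + (a * d + b * c) * e ≡ a * (c * f + d * e) + b * (c * e)
  assoc₂ = solve-∀
  identityˡ₂ : ∀ a b → 1 * b + 0 * a ≡ b
  identityˡ₂ = solve-∀
  comm₂ : ∀ a b c d → a * d + b * c ≡ c * b + d * a
  comm₂ = solve-∀

𝔻-commutativeSemiring : CommutativeSemiring 0ℓ 0ℓ
𝔻-commutativeSemiring = record
  { isCommutativeSemiring = isCommutativeSemiringʳ record
    { +-isCommutativeMonoid = +ᴰ-isCommutativeMonoid
    ; *-isCommutativeMonoid = *ᴰ-isCommutativeMonoid
    ; distribˡ = λ { (a , b) (c , d) (e , f) → cong₂ _,_ (ℕ.*-distribˡ-+ a c e) (distribˡ₂ a b c d e f) }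
    ; zeroʳ    = λ { (a , b) → cong₂ _,_ (ℕ.*-zeroʳ a) (zeroʳ₂ a b) }
    }
  }
  where
  distribˡ₂ : ∀ a b c d e f → a * (d + f) + b * (c + e) ≡ a * d + b * c + (a * f + b * e)
  distribˡ₂ = solve-∀
  zeroʳ₂ : ∀ a b → a * 0 + b * 0 ≡ 0
  zeroʳ₂ = solve-∀

open CommutativeSemiring 𝔻-commutativeSemiring using (semiring)
open SumsAndProducts semiring
open import Algebra.Properties.Semiring.Exp semiring using (_^_)
module ℕ∑ = SumsAndProducts ℕ.+-*-semiring

tangent-∑ : {X : Set} (xs : List X) (F : X → 𝔻) → proj₂ (∑ xs F) ≡ ℕ∑.∑ xs (λ x → proj₂ (F x))
tangent-∑ []       F = refl
tangent-∑ (x ∷ xs) F = cong (proj₂ (F x) +_) (tangent-∑ xs F)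

[1+ε]^ : ∀ c → (1ᴰ +ᴰ ε) ^ c ≡ (1 , c)
[1+ε]^ zero    = refl
[1+ε]^ (suc c) rewrite [1+ε]^ c = cong (1 ,_) (tangent-step c)
  where
  tangent-step : ∀ c → 1 * c + 1 * 1 ≡ suc c
  tangent-step = solve-∀

tangent-ε^ : ∀ c → proj₂ (ε ^ c) ≡ b2n (c ≡ᵇ 1)
tangent-ε^ zero          = refl
tangent-ε^ (suc zero)    = refl
tangent-ε^ (suc (suc c)) = refl

cellWeight : Bool → Bool → Bool → 𝔻
cellWeight r p s = [ (if r then s else true) ∧ (if s then p else true) ]· ε ^ b2n (s ∧ not r)

∑-cellWeight : ∀ r p →
  ∑ (true ∷ false ∷ []) (cellWeight r p) ≡ [ if r then p else true ]· (1ᴰ +ᴰ ε) ^ b2n (p ∧ not r)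
∑-cellWeight true  true  = refl
∑-cellWeight true  false = refl
∑-cellWeight false true  = refl
∑-cellWeight false false = refl

module _ {n m : ℕ} (R P : Mat n m) where

  weight : Mat n m → 𝔻
  weight S = ∏ n (λ i → ∏ m (λ j → cellWeight (R i j) (P i j) (S i j)))

  weight-closed : ∀ S → weight S ≡ [ subsetᵇ R S ∧ subsetᵇ S P ]· ε ^ size (S ∖ R)
  weight-closed S = begin
    weight S
      ≡⟨ ∏-cong n (λ i → ∏-[]·-^ m _ _ ε) ⟩
    ∏ n (λ i → [ allF m (λ j → ⊆ᵢⱼ R S i j ∧ ⊆ᵢⱼ S P i j) ]· ε ^ rowCount (S ∖ R) i)
      ≡⟨ ∏-[]·-^ n _ _ ε ⟩
    [ allF n (λ i → allF m (λ j → ⊆ᵢⱼ R S i j ∧ ⊆ᵢⱼ S P i j)) ]· ε ^ size (S ∖ R)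
      ≡⟨ cong (λ b → [ b ]· ε ^ size (S ∖ R))
              (trans (allF-cong n (λ i → allF-∧ m _ _)) (allF-∧ n _ _)) ⟩
    [ subsetᵇ R S ∧ subsetᵇ S P ]· ε ^ size (S ∖ R) ∎
    where
    open ≡-Reasoning
    ⊆ᵢⱼ : Mat n m → Mat n m → Fin n → Fin m → Bool
    ⊆ᵢⱼ A B i j = if A i j then B i j else true

  ∑-weight : ∑ (allMats n m) weight ≡ [ subsetᵇ R P ]· (1ᴰ +ᴰ ε) ^ size (P ∖ R)
  ∑-weight = begin
    ∑ (allMats n m) weight
      ≡⟨ ∑-allFuns-∏ _ n _ ⟩
    ∏ n (λ i → ∑ (allFuns bools m) (λ row → ∏ m (λ j → cellWeight (R i j) (P i j) (row j))))
      ≡⟨ ∏-cong n (λ i → ∑-allFuns-∏ bools m (λ j → cellWeight (R i j) (P i j))) ⟩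
    ∏ n (λ i → ∏ m (λ j → ∑ bools (cellWeight (R i j) (P i j))))
      ≡⟨ ∏-cong n (λ i → ∏-cong m (λ j → ∑-cellWeight (R i j) (P i j))) ⟩
    ∏ n (λ i → ∏ m (λ j → [ if R i j then P i j else true ]· (1ᴰ +ᴰ ε) ^ b2n ((P ∖ R) i j)))
      ≡⟨ ∏-cong n (λ i → ∏-[]·-^ m _ _ (1ᴰ +ᴰ ε)) ⟩
    ∏ n (λ i → [ allF m (λ j → if R i j then P i j else true) ]· (1ᴰ +ᴰ ε) ^ rowCount (P ∖ R) i)
      ≡⟨ ∏-[]·-^ n _ _ (1ᴰ +ᴰ ε) ⟩
    [ subsetᵇ R P ]· (1ᴰ +ᴰ ε) ^ size (P ∖ R) ∎
    where
    open ≡-Reasoning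
    bools : List Bool
    bools = true ∷ false ∷ []

tangent-weight : ∀ {n m} d (R P : Mat n m) → size R ≡ d → isRook P ≡ true → ∀ S →
  proj₂ (weight R P S) ≡ b2n (isExtensionᵇ d R S ∧ subsetᵇ S P)
tangent-weight {n} {m} d R P |R|≡d rook S =
  trans (cong proj₂ (weight-closed R P S)) (by-cases (subsetᵇ R S) (subsetᵇ S P) refl refl)
  where
  by-cases : ∀ a b → subsetᵇ R S ≡ a → subsetᵇ S P ≡ b →
    proj₂ ([ a ∧ b ]· ε ^ size (S ∖ R)) ≡ b2n (isExtensionᵇ d R S ∧ subsetᵇ S P)
  by-cases true  true  R⊆S S⊆P = trans (tangent-ε^ (size (S ∖ R))) (cong b2n (sym (begin
    isExtensionᵇ d R S ∧ subsetᵇ S P  ≡⟨ cong (isExtensionᵇ d R S ∧_) S⊆P ⟩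
    isExtensionᵇ d R S ∧ true         ≡⟨ Bool.∧-identityʳ _ ⟩
    isExtensionᵇ d R S                ≡⟨ isExtensionᵇ-between d R S P |R|≡d rook R⊆S S⊆P ⟩
    (size (S ∖ R) ≡ᵇ 1)               ∎)))
    where open ≡-Reasoning
  by-cases true  false R⊆S S⊆P = cong b2n (sym (trans (cong (isExtensionᵇ d R S ∧_) S⊆P) (Bool.∧-zeroʳ _)))
  by-cases false b     R⊆S S⊆P =
    cong b2n (sym (trans (cong (λ x → (inZᵇ n m (suc d) S ∧ x) ∧ subsetᵇ S P) R⊆S)
                         (cong (_∧ subsetᵇ S P) (Bool.∧-zeroʳ _))))

tangent-[]·-[1+ε]^ : ∀ b c → proj₂ ([ b ]· (1ᴰ +ᴰ ε) ^ c) ≡ (if b then c else 0)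
tangent-[]·-[1+ε]^ true  c = cong proj₂ ([1+ε]^ c)
tangent-[]·-[1+ε]^ false c = refl

count-extensions-within : ∀ {n m} d (R P : Mat n m) → size R ≡ d → isRook P ≡ true →
  ℕ∑.∑ (allMats n m) (λ S → b2n (isExtensionᵇ d R S ∧ subsetᵇ S P)) ≡ (if subsetᵇ R P then size (P ∖ R) else 0)
count-extensions-within {n} {m} d R P |R|≡d rook = begin
  ℕ∑.∑ (allMats n m) (λ S → b2n (isExtensionᵇ d R S ∧ subsetᵇ S P))
    ≡⟨ ℕ∑.∑-cong (allMats n m) (λ S → tangent-weight d R P |R|≡d rook S) ⟨
  ℕ∑.∑ (allMats n m) (λ S → proj₂ (weight R P S))
    ≡⟨ tangent-∑ (allMats n m) (weight R P) ⟨
  proj₂ (∑ (allMats n m) (weight R P))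
    ≡⟨ cong proj₂ (∑-weight R P) ⟩
  proj₂ ([ subsetᵇ R P ]· (1ᴰ +ᴰ ε) ^ size (P ∖ R))
    ≡⟨ tangent-[]·-[1+ε]^ (subsetᵇ R P) (size (P ∖ R)) ⟩
  (if subsetᵇ R P then size (P ∖ R) else 0) ∎
  where open ≡-Reasoning

fromℕ : ℕ → ℚ
fromℕ k = mkℚ (ℤ.+ k) 0 (coprime-sym (1-coprimeTo k))

fromℕ-+ : ∀ a b → fromℕ (a + b) ≡ fromℕ a ℚ.+ fromℕ b
fromℕ-+ a b = trans (sym (ℚ.normalize-coprime (coprime-sym (1-coprimeTo (a + b)))))
                    (ℚ./-cong {ℤ.+ (a + b)} {1} (sym (cong₂ ℤ._+_ (ℤ.*-identityʳ (ℤ.+ a)) (ℤ.*-identityʳ (ℤ.+ b)))) refl)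

inv-*-fromℕ : ∀ k → inv (suc k) ℚ.* fromℕ (suc k) ≡ 1ℚ
inv-*-fromℕ k = trans (cong (ℚ._* fromℕ (suc k)) (ℚ.normalize-coprime (1-coprimeTo (suc k))))
                      (ℚ.*-inverseˡ (fromℕ (suc k)))

entry≡fromℕ : ∀ b → entry b ≡ fromℕ (b2n b)
entry≡fromℕ true  = refl
entry≡fromℕ false = refl

prodQ-cong : ∀ k {f g : Fin k → ℚ} → (∀ i → f i ≡ g i) → prodQ k f ≡ prodQ k g
prodQ-cong zero    f≡g = refl
prodQ-cong (suc k) f≡g = cong₂ ℚ._*_ (f≡g zero) (prodQ-cong k (λ i → f≡g (suc i)))

prodQ-entry : ∀ k (f : Fin k → Bool) → prodQ k (λ i → entry (f i)) ≡ entry (allF k f)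
prodQ-entry zero    f = refl
prodQ-entry (suc k) f rewrite prodQ-entry k (λ i → f (suc i)) = entry-* (f zero) _
  where
  entry-* : ∀ a b → entry a ℚ.* entry b ≡ entry (a ∧ b)
  entry-* true  true  = refl
  entry-* true  false = refl
  entry-* false true  = refl
  entry-* false false = refl

evalPoly-mono : ∀ {n m} (S P : Mat n m) → evalPoly (mono S) P ≡ entry (subsetᵇ S P)
evalPoly-mono {n} {m} S P = begin
  1ℚ ℚ.* evalMono (monoR S) P ℚ.+ 0ℚ
    ≡⟨ trans (ℚ.+-identityʳ _) (ℚ.*-identityˡ _) ⟩
  prodQ n (λ i → prodQ m (λ j → powQ (entry (P i j)) (b2n (S i j))))
    ≡⟨ prodQ-cong n (λ i → trans (prodQ-cong m (λ j → cell (S i j) (P i j))) (prodQ-entry m _)) ⟩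
  prodQ n (λ i → entry (allF m (λ j → if S i j then P i j else true)))
    ≡⟨ prodQ-entry n _ ⟩
  entry (subsetᵇ S P) ∎
  where
  open ≡-Reasoning
  cell : ∀ s p → powQ (entry p) (b2n s) ≡ entry (if s then p else true)
  cell true  true  = refl
  cell true  false = refl
  cell false p     = refl

evalPoly-++ : ∀ {n m} (f g : Poly n m) P → evalPoly (f ++ g) P ≡ evalPoly f P ℚ.+ evalPoly g P
evalPoly-++ []            g P = sym (ℚ.+-identityˡ _)
evalPoly-++ ((c , e) ∷ f) g P =
  trans (cong (c ℚ.* evalMono e P ℚ.+_) (evalPoly-++ f g P))
        (sym (ℚ.+-assoc (c ℚ.* evalMono e P) (evalPoly f P) (evalPoly g P)))

evalPoly-scale : ∀ {n m} a (f : Poly n m) P → evalPoly (scale a f) P ≡ a ℚ.* evalPoly f P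
evalPoly-scale a []            P = sym (ℚ.*-zeroʳ a)
evalPoly-scale a ((c , e) ∷ f) P =
  trans (cong₂ ℚ._+_ (ℚ.*-assoc a c _) (evalPoly-scale a f P)) (sym (ℚ.*-distribˡ-+ a _ _))

evalPoly-sub : ∀ {n m} (f g : Poly n m) P → evalPoly (f -P g) P ≡ evalPoly f P ℚ.- evalPoly g P
evalPoly-sub f g P = begin
  evalPoly (f ++ scale (- 1ℚ) g) P            ≡⟨ evalPoly-++ f (scale (- 1ℚ) g) P ⟩
  evalPoly f P ℚ.+ evalPoly (scale (- 1ℚ) g) P ≡⟨ cong (evalPoly f P ℚ.+_) (evalPoly-scale (- 1ℚ) g P) ⟩
  evalPoly f P ℚ.+ (- 1ℚ) ℚ.* evalPoly g P     ≡⟨ cong (evalPoly f P ℚ.+_) (ℚ.neg-distribˡ-* 1ℚ (evalPoly g P)) ⟨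
  evalPoly f P ℚ.+ - (1ℚ ℚ.* evalPoly g P)     ≡⟨ cong (λ x → evalPoly f P ℚ.- x) (ℚ.*-identityˡ (evalPoly g P)) ⟩
  evalPoly f P ℚ.- evalPoly g P ∎
  where open ≡-Reasoning

evalPoly-filter-monos : ∀ {n m} (q : Mat n m → Bool) (L : List (Mat n m)) P →
  evalPoly (concatMap mono (filterᵇ q L)) P ≡ fromℕ (ℕ∑.∑ L (λ S → b2n (q S ∧ subsetᵇ S P)))
evalPoly-filter-monos q []      P = refl
evalPoly-filter-monos q (S ∷ L) P with q S
... | true  = begin
  evalPoly (mono S ++ concatMap mono (filterᵇ q L)) P
    ≡⟨ evalPoly-++ (mono S) (concatMap mono (filterᵇ q L)) P ⟩
  evalPoly (mono S) P ℚ.+ evalPoly (concatMap mono (filterᵇ q L)) P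
    ≡⟨ cong₂ ℚ._+_ (trans (evalPoly-mono S P) (entry≡fromℕ (subsetᵇ S P))) (evalPoly-filter-monos q L P) ⟩
  fromℕ (b2n (subsetᵇ S P)) ℚ.+ fromℕ (ℕ∑.∑ L (λ S → b2n (q S ∧ subsetᵇ S P)))
    ≡⟨ fromℕ-+ (b2n (subsetᵇ S P)) _ ⟨
  fromℕ (b2n (subsetᵇ S P) + ℕ∑.∑ L (λ S → b2n (q S ∧ subsetᵇ S P))) ∎
  where open ≡-Reasoning
... | false = evalPoly-filter-monos q L P

evalPoly-extSum : ∀ {n m} d (R P : Mat n m) → size R ≡ d → isRook P ≡ true →
  evalPoly (extSum d R) P ≡ fromℕ (if subsetᵇ R P then size (P ∖ R) else 0)
evalPoly-extSum {n} {m} d R P |R|≡d rook =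
  trans (evalPoly-filter-monos (isExtensionᵇ d R) (allMats n m) P)
        (cong fromℕ (count-extensions-within d R P |R|≡d rook))

InZ⇒isRook : ∀ {n m} k (S : Mat n m) → InZ n m k S → isRook S ≡ true
InZ⇒isRook k S S∈Z = proj₁ (∧≡true⇒both S∈Z)

InZ⇒size : ∀ {n m} k (S : Mat n m) → InZ n m k S → size S ≡ k
InZ⇒size k S S∈Z = ℕ.≡ᵇ⇒≡ _ _ (Equivalence.from Bool.T-≡ (proj₂ (∧≡true⇒both S∈Z)))

averaged-extSum : ∀ {n m} d r (R P : Mat n m) → d < r → size R ≡ d → InZ n m r P →
  inv (r ∸ d) ℚ.* evalPoly (extSum d R) P ≡ entry (subsetᵇ R P)
averaged-extSum d r R P d<r |R|≡d P∈Z
  rewrite evalPoly-extSum d R P |R|≡d (InZ⇒isRook r P P∈Z) with subsetᵇ R P in R⊆P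
... | false = ℚ.*-zeroʳ (inv (r ∸ d))
... | true  = begin
  inv (r ∸ d) ℚ.* fromℕ (size (P ∖ R))
    ≡⟨ cong (λ k → inv (r ∸ d) ℚ.* fromℕ k) |P∖R|≡r∸d ⟩
  inv (r ∸ d) ℚ.* fromℕ (r ∸ d)
    ≡⟨ cong (λ k → inv k ℚ.* fromℕ k) (ℕ.+-∸-assoc 1 d<r) ⟩
  inv (suc (r ∸ suc d)) ℚ.* fromℕ (suc (r ∸ suc d))
    ≡⟨ inv-*-fromℕ (r ∸ suc d) ⟩
  1ℚ ∎
  where
  open ≡-Reasoning
  |P∖R|≡r∸d : size (P ∖ R) ≡ r ∸ d
  |P∖R|≡r∸d = trans (size-∖≡∸ R P R⊆P) (cong₂ _∸_ (InZ⇒size r P P∈Z) |R|≡d)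

-- The hypotheses r ≤ n, r ≤ m and 0 < n, m only make Z_{n,m,r} nonempty; the congruence does not need them.
lemma3p16 : (n m d r : ℕ) → 0 < n → 0 < m → d < r → r ≤ n → r ≤ m →
    (R : Mat n m) → InZ n m d R →
    CongModZ n m r (mono R) (scale (inv (r ∸ d)) (extSum d R))
lemma3p16 n m d r _ _ d<r _ _ R R∈Z P P∈Z = begin
  evalPoly (mono R -P scale (inv (r ∸ d)) (extSum d R)) P
    ≡⟨ evalPoly-sub (mono R) (scale (inv (r ∸ d)) (extSum d R)) P ⟩
  evalPoly (mono R) P ℚ.- evalPoly (scale (inv (r ∸ d)) (extSum d R)) P
    ≡⟨ cong (λ x → evalPoly (mono R) P ℚ.- x) (evalPoly-scale (inv (r ∸ d)) (extSum d R) P) ⟩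
  evalPoly (mono R) P ℚ.- inv (r ∸ d) ℚ.* evalPoly (extSum d R) P
    ≡⟨ cong₂ ℚ._-_ (evalPoly-mono R P) (averaged-extSum d r R P d<r (InZ⇒size d R R∈Z) P∈Z) ⟩
  entry (subsetᵇ R P) ℚ.- entry (subsetᵇ R P)
    ≡⟨ ℚ.+-inverseʳ (entry (subsetᵇ R P)) ⟩
  0ℚ ∎
  where open ≡-Reasoning
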